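{- The strong chromatic index of a cubic graph $G$ equals $5$ if and only if $G$ covers the Petersen graph.
   Context: A strong edge coloring of a graph is a proper edge coloring with no bichromatic path of length three; the strong chromatic index is the minimum number of colors in such a coloring. A surjective graph homomorphism $f\colon\tilde G\to G$ is a covering projection if for every vertex $\tilde v$ of $\tilde G$ the set of edges incident with $\tilde v$ is mapped bijectively onto the set of edges incident with $f(\tilde v)$; $\tilde G$ covers $G$ if such a projection exists. -}

module Defs where

open import Level using (0ℓ) renaming (suc to lsuc)
open import Data.Nat using (ℕ; _≤_)
open import Data.Nat.Base using (_≡ᵇ_)
open import Data.Fin using (Fin)
open import Data.Bool using (Bool; true; false; not; _∧_; _∨_; T)
open import Data.Product using (Σ; ∃; _×_; _,_)
open import Data.Sum using (_⊎_)
open import Data.Vec using (Vec; lookup; _∷_; [])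
open import Relation.Binary.PropositionalEquality using (_≡_)
open import Relation.Nullary using (¬_)

record Graph : Set₁ where
  field
    n       : ℕ
    Adj     : Fin n → Fin n → Set
    sym     : ∀ {u v} → Adj u v → Adj v u
    irrefl  : ∀ {v} → ¬ Adj v v

open Graph public

Cubic : Graph → Set
Cubic G = ∀ v → Σ (Fin (n G)) λ a → Σ (Fin (n G)) λ b → Σ (Fin (n G)) λ c →
  Adj G v a × Adj G v b × Adj G v c ×
  ¬ a ≡ b × ¬ a ≡ c × ¬ b ≡ c ×
  (∀ w → Adj G v w → w ≡ a ⊎ w ≡ b ⊎ w ≡ c)

-- An edge colouring with k colours: a colour for each ordered pair of
-- vertices, required to be symmetric on edges (so it is a colouring of the
-- unordered edges {u,v}); values on non-adjacent pairs are irrelevant.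
record EdgeColouring (G : Graph) (k : ℕ) : Set where
  field
    col  : Fin (n G) → Fin (n G) → Fin k
    symm : ∀ {u v} → Adj G u v → col u v ≡ col v u

open EdgeColouring public

Proper : ∀ {G k} → EdgeColouring G k → Set
Proper {G} c = ∀ {u v w} → Adj G v u → Adj G v w → ¬ u ≡ w →
  ¬ col c v u ≡ col c v w

-- A path of length three a-b-c-d (distinct vertices) is bichromatic when its
-- edges use only two colours; for a proper colouring this means the first
-- and third edges share a colour.
BichromaticP3 : ∀ {G k} → EdgeColouring G k → Set
BichromaticP3 {G} c = Σ (Fin (n G)) λ a → Σ (Fin (n G)) λ b →
  Σ (Fin (n G)) λ x → Σ (Fin (n G)) λ d →
  Adj G a b × Adj G b x × Adj G x d ×
  ¬ a ≡ b × ¬ a ≡ x × ¬ a ≡ d × ¬ b ≡ x × ¬ b ≡ d × ¬ x ≡ d ×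
  col c a b ≡ col c x d

Strong : ∀ {G k} → EdgeColouring G k → Set
Strong c = Proper c × ¬ BichromaticP3 c

StrongColourable : Graph → ℕ → Set
StrongColourable G k = Σ (EdgeColouring G k) Strong

IsStrongChromaticIndex : Graph → ℕ → Set
IsStrongChromaticIndex G k =
  StrongColourable G k × (∀ m → StrongColourable G m → k ≤ m)

record CoveringProjection (H G : Graph) : Set where
  field
    f        : Fin (n H) → Fin (n G)
    hom      : ∀ {u v} → Adj H u v → Adj G (f u) (f v)
    surj     : ∀ w → Σ (Fin (n H)) λ v → f v ≡ w
    -- edges at ṽ map bijectively onto edges at f ṽ
    localInj : ∀ {v u u'} → Adj H v u → Adj H v u' → f u ≡ f u' → u ≡ u'
    localSurj : ∀ v w → Adj G (f v) w → Σ (Fin (n H)) λ u → Adj H v u × f u ≡ w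

Covers : Graph → Graph → Set
Covers H G = CoveringProjection H G

-- Petersen graph as the Kneser graph K(5,2): vertices are the 2-subsets of
-- {0,..,4}, adjacent iff disjoint.
private
  pairs : Vec (ℕ × ℕ) 10
  pairs = (0 , 1) ∷ (0 , 2) ∷ (0 , 3) ∷ (0 , 4) ∷ (1 , 2) ∷
          (1 , 3) ∷ (1 , 4) ∷ (2 , 3) ∷ (2 , 4) ∷ (3 , 4) ∷ []

  disjoint : ℕ × ℕ → ℕ × ℕ → Bool
  disjoint (a , b) (c , d) =
    not ((a ≡ᵇ c) ∨ (a ≡ᵇ d) ∨ (b ≡ᵇ c) ∨ (b ≡ᵇ d))

  petAdj : Fin 10 → Fin 10 → Bool
  petAdj u v = disjoint (lookup pairs u) (lookup pairs v)

  petSym : ∀ {u v} → T (petAdj u v) → T (petAdj v u)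
  petSym {u} {v} p with lookup pairs u | lookup pairs v
  ... | (a , b) | (c , d) = helper a b c d p
    where
    open import Data.Nat.Properties using (≡ᵇ⇒≡; ≡⇒≡ᵇ)
    open import Data.Bool.Properties using (∨-comm; ∨-assoc)
    open import Relation.Binary.PropositionalEquality using (cong; subst)
    sw : ∀ x y → (x ≡ᵇ y) ≡ (y ≡ᵇ x)
    sw ℕ.zero ℕ.zero = _≡_.refl
    sw ℕ.zero (ℕ.suc y) = _≡_.refl
    sw (ℕ.suc x) ℕ.zero = _≡_.refl
    sw (ℕ.suc x) (ℕ.suc y) = sw x y
    helper : ∀ a b c d → T (disjoint (a , b) (c , d)) → T (disjoint (c , d) (a , b))
    helper a b c d p rewrite sw c a | sw c b | sw d a | sw d b
      with (a ≡ᵇ c) | (a ≡ᵇ d) | (b ≡ᵇ c) | (b ≡ᵇ d)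
    ... | false | false | false | false = p

  petIrr : ∀ {v} → ¬ T (petAdj v v)
  petIrr {v} with lookup pairs v
  ... | (a , b) = helper a b
    where
    open import Data.Nat.Properties using (≡⇒≡ᵇ)
    helper : ∀ a b → ¬ T (disjoint (a , b) (a , b))
    helper a b p with (a ≡ᵇ a) in e
    ... | true = p
    ... | false with ≡⇒≡ᵇ a a _≡_.refl
    ...   | q rewrite e = q

Petersen : Graph
Petersen = record
  { n = 10 ; Adj = λ u v → T (petAdj u v) ; sym = λ {u} {v} → petSym {u} {v} ; irrefl = λ {v} → petIrr {v} }

-- In a strong edge colouring of a cubic graph an edge vu and the four edges meeting it
-- get five distinct colours, so at least five colours are needed; with exactly five,
-- the two colours missing at a vertex v form a 2-subset of {0,…,4}, i.e. a vertex of
-- the Petersen graph K(5,2).  If vu has colour e, the colours at v and at u are e plus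
-- two disjoint pairs, so the missing pairs of v and u are disjoint and the Petersen edge
-- between them has colour e, where the Petersen edge {p, q} is coloured by the element
-- outside p ∪ q.  Properness of both colourings makes v ↦ (missing pair) a local
-- bijection, and as the Petersen graph has diameter two it is onto.  Conversely that
-- colouring of the Petersen graph is strong, and strong colourings pull back along
-- covering projections.
module Submission where

open import Data.Bool using (Bool; not; _∨_)
open import Data.Empty using (⊥-elim)
open import Data.Fin using (Fin; zero; toℕ; _≟_)
open import Data.Fin.Properties using (all?; any?; injective⇒≤)
open import Data.List using (allFin; find)
open import Data.Maybe using (fromMaybe)
open import Data.Nat using (ℕ; zero; suc; _≤_; _≡ᵇ_)
import Data.Nat.Properties as ℕ
open import Data.Product using (Σ; ∃; _×_; _,_; proj₁; proj₂)
open import Data.Sum using (_⊎_; inj₁; inj₂)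
open import Data.Unit using (tt)
open import Data.Vec using (Vec; lookup; _∷_; [])
open import Data.Vec.Relation.Unary.All using ([]; _∷_)
open import Data.Vec.Relation.Unary.AllPairs using ([]; _∷_; allPairs?)
open import Data.Vec.Relation.Unary.Unique.Propositional using (Unique)
open import Data.Vec.Relation.Unary.Unique.Propositional.Properties using (lookup-injective)
open import Function using (case_of_)
open import Relation.Binary.PropositionalEquality as ≡ using (_≡_; _≢_; refl; trans; ≢-sym)
open import Relation.Nullary using (¬_; Dec; yes; no)
open import Relation.Nullary.Decidable
  using (¬?; _×-dec_; _⊎-dec_; _→-dec_; T?; toWitness; decidable-stable)

open import Defs

adj⇒≢ : ∀ G {u v} → Adj G u v → u ≢ v
adj⇒≢ G uv refl = irrefl G uv

fin-stable : ∀ m → ¬ ¬ Fin m → Fin m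
fin-stable zero ¬¬fin = ⊥-elim (¬¬fin λ ())
fin-stable (suc m) _ = zero

strongColourable-empty : ∀ {G} → ¬ Fin (n G) → StrongColourable G 0
strongColourable-empty ¬v =
  record { col = λ u _ → ⊥-elim (¬v u) ; symm = λ {u} _ → ⊥-elim (¬v u) } ,
  (λ {u} _ _ _ _ → ⊥-elim (¬v u)) , λ { (a , _) → ⊥-elim (¬v a) }

record Neighbours (G : Graph) (v : Fin (n G)) : Set where
  field
    x y z    : Fin (n G)
    adj-x    : Adj G v x
    adj-y    : Adj G v y
    adj-z    : Adj G v z
    distinct : Unique (x ∷ y ∷ z ∷ [])
    complete : ∀ {w} → Adj G v w → w ≡ x ⊎ w ≡ y ⊎ w ≡ z

record OtherNeighbours (G : Graph) (v u : Fin (n G)) : Set where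
  field
    u₁ u₂    : Fin (n G)
    adj₁     : Adj G v u₁
    adj₂     : Adj G v u₂
    distinct : Unique (u ∷ u₁ ∷ u₂ ∷ [])

module CubicGraph {G : Graph} (cubic : Cubic G) where

  neighbours : ∀ v → Neighbours G v
  neighbours v with cubic v
  ... | x , y , z , adj-x , adj-y , adj-z , x≢y , x≢z , y≢z , complete = record
    { x = x ; y = y ; z = z ; adj-x = adj-x ; adj-y = adj-y ; adj-z = adj-z
    ; distinct = (x≢y ∷ x≢z ∷ []) ∷ (y≢z ∷ []) ∷ [] ∷ []
    ; complete = λ {w} → complete w }

  otherNeighbours : ∀ {v u} → Adj G v u → OtherNeighbours G v u
  otherNeighbours {v} vu with neighbours v
  ... | record { adj-x = adj-x ; adj-y = adj-y ; adj-z = adj-z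
               ; distinct = (x≢y ∷ x≢z ∷ []) ∷ (y≢z ∷ []) ∷ [] ∷ [] ; complete = complete }
    with complete vu
  ... | inj₁ refl = record
    { adj₁ = adj-y ; adj₂ = adj-z ; distinct = (x≢y ∷ x≢z ∷ []) ∷ (y≢z ∷ []) ∷ [] ∷ [] }
  ... | inj₂ (inj₁ refl) = record
    { adj₁ = adj-x ; adj₂ = adj-z ; distinct = (≢-sym x≢y ∷ y≢z ∷ []) ∷ (x≢z ∷ []) ∷ [] ∷ [] }
  ... | inj₂ (inj₂ refl) = record
    { adj₁ = adj-x ; adj₂ = adj-y
    ; distinct = (≢-sym x≢z ∷ ≢-sym y≢z ∷ []) ∷ (x≢y ∷ []) ∷ [] ∷ [] }

module StrongColouring {G : Graph} {k : ℕ} (c : EdgeColouring G k) (strong : Strong c) where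

  open OtherNeighbours

  private
    proper = proj₁ strong
    cl = col c

  col-≢-at-distance-one : ∀ {v u u′ w} → Adj G v u → Adj G v u′ → u ≢ u′ →
                          Adj G u w → w ≢ v → cl v u′ ≢ cl u w
  col-≢-at-distance-one {v} {u} {u′} {w} vu vu′ u≢u′ uw w≢v eq with u′ ≟ w
  ... | yes refl = proper (Graph.sym G vu′) (Graph.sym G uw) (adj⇒≢ G vu)
                          (trans (≡.sym (symm c vu′)) (trans eq (symm c uw)))
  ... | no u′≢w = proj₂ strong
    ( u′ , v , u , w , Graph.sym G vu′ , vu , uw
    , ≢-sym (adj⇒≢ G vu′) , ≢-sym u≢u′ , u′≢w , adj⇒≢ G vu , ≢-sym w≢v , adj⇒≢ G uw
    , trans (≡.sym (symm c vu′)) eq )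

  colours-at-vertex-unique : ∀ {v x y z} → Adj G v x → Adj G v y → Adj G v z →
                             Unique (x ∷ y ∷ z ∷ []) → Unique (cl v x ∷ cl v y ∷ cl v z ∷ [])
  colours-at-vertex-unique vx vy vz ((x≢y ∷ x≢z ∷ []) ∷ (y≢z ∷ []) ∷ [] ∷ []) =
    (proper vx vy x≢y ∷ proper vx vz x≢z ∷ []) ∷ (proper vy vz y≢z ∷ []) ∷ [] ∷ []

  colours-around-edge-unique : ∀ {v u} (vu : Adj G v u)
    (O : OtherNeighbours G v u) (P : OtherNeighbours G u v) →
    Unique (cl v u ∷ cl v (u₁ O) ∷ cl v (u₂ O) ∷ cl u (u₁ P) ∷ cl u (u₂ P) ∷ [])
  colours-around-edge-unique {v} {u} vu O P
    with colours-at-vertex-unique vu (adj₁ O) (adj₂ O) (distinct O)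
       | colours-at-vertex-unique (Graph.sym G vu) (adj₁ P) (adj₂ P) (distinct P)
       | distinct O | distinct P
  ... | (e≢x₁ ∷ e≢x₂ ∷ []) ∷ (x₁≢x₂ ∷ []) ∷ [] ∷ []
      | (e≢y₁ ∷ e≢y₂ ∷ []) ∷ (y₁≢y₂ ∷ []) ∷ [] ∷ []
      | (u≢u₁ ∷ u≢u₂ ∷ []) ∷ _ | (v≢w₁ ∷ v≢w₂ ∷ []) ∷ _ =
    (e≢x₁ ∷ e≢x₂ ∷ via-symm e≢y₁ ∷ via-symm e≢y₂ ∷ [])
    ∷ (x₁≢x₂ ∷ far (adj₁ O) u≢u₁ (adj₁ P) v≢w₁ ∷ far (adj₁ O) u≢u₁ (adj₂ P) v≢w₂ ∷ [])
    ∷ (far (adj₂ O) u≢u₂ (adj₁ P) v≢w₁ ∷ far (adj₂ O) u≢u₂ (adj₂ P) v≢w₂ ∷ [])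
    ∷ (y₁≢y₂ ∷ [])
    ∷ []
    ∷ []
    where
    via-symm : ∀ {w} → cl u v ≢ cl u w → cl v u ≢ cl u w
    via-symm uv≢uw eq = uv≢uw (trans (≡.sym (symm c vu)) eq)
    far : ∀ {x w} → Adj G v x → u ≢ x → Adj G u w → v ≢ w → cl v x ≢ cl u w
    far vx u≢x uw v≢w = col-≢-at-distance-one vu vx u≢x uw (≢-sym v≢w)

  five-colours-at-edge : ∀ {v u} → Adj G v u →
                         OtherNeighbours G v u → OtherNeighbours G u v → 5 ≤ k
  five-colours-at-edge vu O P =
    injective⇒≤ λ {i} {j} → lookup-injective (colours-around-edge-unique vu O P) i j

module Petersen where

  Vertex = Fin 10
  Colour = Fin 5

  -- The encoding of Defs.Petersen, restated so that `Adj Petersen p q` is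
  -- definitionally `T (disjointᵇ (lookup pairs p) (lookup pairs q))`, hence decidable.
  pairs : Vec (ℕ × ℕ) 10
  pairs = (0 , 1) ∷ (0 , 2) ∷ (0 , 3) ∷ (0 , 4) ∷ (1 , 2) ∷
          (1 , 3) ∷ (1 , 4) ∷ (2 , 3) ∷ (2 , 4) ∷ (3 , 4) ∷ []

  disjointᵇ : ℕ × ℕ → ℕ × ℕ → Bool
  disjointᵇ (a , b) (c , d) = not ((a ≡ᵇ c) ∨ (a ≡ᵇ d) ∨ (b ≡ᵇ c) ∨ (b ≡ᵇ d))

  adj? : ∀ p q → Dec (Adj Petersen p q)
  adj? p q = T? (disjointᵇ (lookup pairs p) (lookup pairs q))

  _∈ᴾ_ : Colour → Vertex → Set
  k ∈ᴾ p = toℕ k ≡ proj₁ (lookup pairs p) ⊎ toℕ k ≡ proj₂ (lookup pairs p)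

  _∉ᴾ_ : Colour → Vertex → Set
  k ∉ᴾ p = ¬ k ∈ᴾ p

  _∉ᴾ?_ : ∀ k p → Dec (k ∉ᴾ p)
  k ∉ᴾ? p = ¬? ((toℕ k ℕ.≟ _) ⊎-dec (toℕ k ℕ.≟ _))

  unique? : ∀ {m} (xs : Vec Colour m) → Dec (Unique xs)
  unique? = allPairs? λ x y → ¬? (x ≟ y)

  -- Both searches succeed whenever they are used; `zero` is a junk default.
  pairAvoiding : Colour → Colour → Colour → Vertex
  pairAvoiding x y z =
    fromMaybe zero (find (λ p → x ∉ᴾ? p ×-dec y ∉ᴾ? p ×-dec z ∉ᴾ? p) (allFin 10))

  colour : Vertex → Vertex → Colour
  colour p q = fromMaybe zero (find (λ k → k ∉ᴾ? p ×-dec k ∉ᴾ? q) (allFin 5))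

  pairAvoiding-avoids : ∀ x y z → Unique (x ∷ y ∷ z ∷ []) →
    x ∉ᴾ pairAvoiding x y z × y ∉ᴾ pairAvoiding x y z × z ∉ᴾ pairAvoiding x y z
  pairAvoiding-avoids = toWitness {a? = all? λ x → all? λ y → all? λ z →
    unique? (x ∷ y ∷ z ∷ []) →-dec
    x ∉ᴾ? pairAvoiding x y z ×-dec y ∉ᴾ? pairAvoiding x y z ×-dec z ∉ᴾ? pairAvoiding x y z} tt

  pairAvoiding-unique : ∀ x y z p → Unique (x ∷ y ∷ z ∷ []) →
    x ∉ᴾ p → y ∉ᴾ p → z ∉ᴾ p → p ≡ pairAvoiding x y z
  pairAvoiding-unique = toWitness {a? = all? λ x → all? λ y → all? λ z → all? λ p →
    unique? (x ∷ y ∷ z ∷ []) →-dec x ∉ᴾ? p →-dec y ∉ᴾ? p →-dec z ∉ᴾ? p →-dec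
    p ≟ pairAvoiding x y z} tt

  pairAvoiding-edge : ∀ e x₁ x₂ y₁ y₂ → Unique (e ∷ x₁ ∷ x₂ ∷ y₁ ∷ y₂ ∷ []) →
    Adj Petersen (pairAvoiding e x₁ x₂) (pairAvoiding e y₁ y₂) ×
    colour (pairAvoiding e x₁ x₂) (pairAvoiding e y₁ y₂) ≡ e
  pairAvoiding-edge = toWitness {a? = all? λ e → all? λ x₁ → all? λ x₂ → all? λ y₁ → all? λ y₂ →
    unique? (e ∷ x₁ ∷ x₂ ∷ y₁ ∷ y₂ ∷ []) →-dec
    adj? (pairAvoiding e x₁ x₂) (pairAvoiding e y₁ y₂) ×-dec
    colour (pairAvoiding e x₁ x₂) (pairAvoiding e y₁ y₂) ≟ e} tt

  colour-at-pairAvoiding : ∀ x y z w → Unique (x ∷ y ∷ z ∷ []) →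
    Adj Petersen (pairAvoiding x y z) w →
    colour (pairAvoiding x y z) w ≡ x ⊎ colour (pairAvoiding x y z) w ≡ y ⊎
    colour (pairAvoiding x y z) w ≡ z
  colour-at-pairAvoiding = toWitness {a? = all? λ x → all? λ y → all? λ z → all? λ w →
    unique? (x ∷ y ∷ z ∷ []) →-dec adj? (pairAvoiding x y z) w →-dec
    (colour (pairAvoiding x y z) w ≟ x ⊎-dec colour (pairAvoiding x y z) w ≟ y ⊎-dec
     colour (pairAvoiding x y z) w ≟ z)} tt

  colour-sym : ∀ p q → Adj Petersen p q → colour p q ≡ colour q p
  colour-sym = toWitness {a? = all? λ p → all? λ q →
    adj? p q →-dec colour p q ≟ colour q p} tt

  colour-proper : ∀ p q r → Adj Petersen p q → Adj Petersen p r → q ≢ r →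
                  colour p q ≢ colour p r
  colour-proper = toWitness {a? = all? λ p → all? λ q → all? λ r →
    adj? p q →-dec adj? p r →-dec ¬? (q ≟ r) →-dec ¬? (colour p q ≟ colour p r)} tt

  colour-no-bichromatic : ∀ p q r s → Adj Petersen p q → Adj Petersen q r → Adj Petersen r s →
    p ≢ r → q ≢ s → colour p q ≢ colour r s
  colour-no-bichromatic = toWitness {a? = all? λ p → all? λ q → all? λ r → all? λ s →
    adj? p q →-dec adj? q r →-dec adj? r s →-dec ¬? (p ≟ r) →-dec ¬? (q ≟ s) →-dec
    ¬? (colour p q ≟ colour r s)} tt

  diameter-two : ∀ p q →
    p ≡ q ⊎ Adj Petersen p q ⊎ ∃ λ m → Adj Petersen p m × Adj Petersen m q
  diameter-two = toWitness {a? = all? λ p → all? λ q →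
    p ≟ q ⊎-dec adj? p q ⊎-dec any? λ m → adj? p m ×-dec adj? m q} tt

  colour-injective : ∀ p q r → Adj Petersen p q → Adj Petersen p r →
                     colour p q ≡ colour p r → q ≡ r
  colour-injective p q r pq pr eq =
    decidable-stable (q ≟ r) λ q≢r → colour-proper p q r pq pr q≢r eq

  petersenColouring : EdgeColouring Petersen 5
  petersenColouring = record { col = colour ; symm = λ {p} {q} → colour-sym p q }

  petersenColouring-strong : Strong petersenColouring
  petersenColouring-strong =
    (λ {q} {p} {r} → colour-proper p q r) ,
    λ { (p , q , r , s , pq , qr , rs , _ , p≢r , _ , _ , q≢s , _ , eq) →
        colour-no-bichromatic p q r s pq qr rs p≢r q≢s eq }

open Petersen using (colour; pairAvoiding; petersenColouring; petersenColouring-strong)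

pullback : ∀ {H G k} → CoveringProjection H G → EdgeColouring G k → EdgeColouring H k
pullback π c = record
  { col = λ u v → col c (f u) (f v) ; symm = λ uv → symm c (hom uv) }
  where open CoveringProjection π

pullback-strong : ∀ {H G k} (π : CoveringProjection H G) (c : EdgeColouring G k) →
                  Strong c → Strong (pullback π c)
pullback-strong {H} {G} π c (proper , no-bichromatic) = pulled-proper , pulled-no-bichromatic
  where
  open CoveringProjection π

  images-≢ : ∀ {v u w} → Adj H v u → Adj H v w → u ≢ w → f u ≢ f w
  images-≢ vu vw u≢w eq = u≢w (localInj vu vw eq)

  pulled-proper : Proper (pullback π c)
  pulled-proper vu vw u≢w = proper (hom vu) (hom vw) (images-≢ vu vw u≢w)

  proper-on-triangle : ∀ {p q r s} → Adj G p q → Adj G q r → Adj G r s → p ≡ s →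
                       col c p q ≢ col c r s
  proper-on-triangle pq qr rs refl eq =
    proper pq (Graph.sym G rs) (adj⇒≢ G qr) (trans eq (symm c rs))

  -- The image of a path of length three may be a triangle.
  pulled-no-bichromatic : ¬ BichromaticP3 (pullback π c)
  pulled-no-bichromatic (a , b , x , d , ab , bx , xd , _ , a≢x , _ , _ , b≢d , _ , eq)
    with f a ≟ f d
  ... | yes fa≡fd = proper-on-triangle (hom ab) (hom bx) (hom xd) fa≡fd eq
  ... | no fa≢fd = no-bichromatic
    ( f a , f b , f x , f d , hom ab , hom bx , hom xd
    , adj⇒≢ G (hom ab) , images-≢ (Graph.sym H ab) bx a≢x , fa≢fd
    , adj⇒≢ G (hom bx) , images-≢ (Graph.sym H bx) xd b≢d , adj⇒≢ G (hom xd) , eq )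

module MissingColours {G : Graph} (cubic : Cubic G) (c : EdgeColouring G 5) (strong : Strong c)
  where

  open Petersen using (_∉ᴾ_; pairAvoiding-avoids; pairAvoiding-unique; pairAvoiding-edge;
                       colour-at-pairAvoiding; colour-injective; diameter-two)
  open CubicGraph {G} cubic
  open StrongColouring c strong
  open OtherNeighbours using (u₁; u₂)

  private
    cl = col c

  missing : Fin (n G) → Petersen.Vertex
  missing v = pairAvoiding (cl v x) (cl v y) (cl v z)
    where open Neighbours (neighbours v)

  missing-avoids : ∀ {v w} → Adj G v w → cl v w ∉ᴾ missing v
  missing-avoids {v} {w} vw = by-cases (complete vw)
    where
    open Neighbours (neighbours v)
    avoids = pairAvoiding-avoids _ _ _ (colours-at-vertex-unique adj-x adj-y adj-z distinct)
    by-cases : w ≡ x ⊎ w ≡ y ⊎ w ≡ z → cl v w ∉ᴾ missing v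
    by-cases (inj₁ refl)        = proj₁ avoids
    by-cases (inj₂ (inj₁ refl)) = proj₁ (proj₂ avoids)
    by-cases (inj₂ (inj₂ refl)) = proj₂ (proj₂ avoids)

  missing-at : ∀ {v u} → Adj G v u → (O : OtherNeighbours G v u) →
    missing v ≡ pairAvoiding (cl v u) (cl v (u₁ O)) (cl v (u₂ O))
  missing-at vu O = pairAvoiding-unique _ _ _ _
    (colours-at-vertex-unique vu adj₁ adj₂ distinct)
    (missing-avoids vu) (missing-avoids adj₁) (missing-avoids adj₂)
    where open OtherNeighbours O using (adj₁; adj₂; distinct)

  missing-edge : ∀ {v u} → Adj G v u →
    Adj Petersen (missing v) (missing u) × colour (missing v) (missing u) ≡ cl v u
  missing-edge {v} {u} vu =
    ≡.subst₂ (λ p q → Adj Petersen p q × colour p q ≡ cl v u)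
      (≡.sym (missing-at vu O)) (≡.sym missing-u)
      (pairAvoiding-edge _ _ _ _ _ (colours-around-edge-unique vu O P))
    where
    O = otherNeighbours vu
    P = otherNeighbours (Graph.sym G vu)
    missing-u : missing u ≡ pairAvoiding (cl v u) (cl u (u₁ P)) (cl u (u₂ P))
    missing-u = trans (missing-at (Graph.sym G vu) P)
                      (≡.cong (λ e → pairAvoiding e (cl u (u₁ P)) (cl u (u₂ P))) (≡.sym (symm c vu)))

  missing-localInj : ∀ {v u u′} → Adj G v u → Adj G v u′ → missing u ≡ missing u′ → u ≡ u′
  missing-localInj {v} {u} {u′} vu vu′ eq = decidable-stable (u ≟ u′) λ u≢u′ →
    proj₁ strong vu vu′ u≢u′ (begin
      cl v u                          ≡⟨ ≡.sym (proj₂ (missing-edge vu)) ⟩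
      colour (missing v) (missing u)  ≡⟨ ≡.cong (colour (missing v)) eq ⟩
      colour (missing v) (missing u′) ≡⟨ proj₂ (missing-edge vu′) ⟩
      cl v u′                         ∎)
    where open ≡.≡-Reasoning

  missing-localSurj : ∀ v p → Adj Petersen (missing v) p →
                      Σ (Fin (n G)) λ u → Adj G v u × missing u ≡ p
  missing-localSurj v p vp = by-cases
    (colour-at-pairAvoiding _ _ _ p (colours-at-vertex-unique adj-x adj-y adj-z distinct) vp)
    where
    open Neighbours (neighbours v)
    lift : ∀ {u} → Adj G v u → colour (missing v) p ≡ cl v u → missing u ≡ p
    lift {u} vu eq = colour-injective (missing v) (missing u) p (proj₁ (missing-edge vu)) vp
                                      (trans (proj₂ (missing-edge vu)) (≡.sym eq))
    by-cases : colour (missing v) p ≡ cl v x ⊎ colour (missing v) p ≡ cl v y ⊎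
               colour (missing v) p ≡ cl v z →
               Σ (Fin (n G)) λ u → Adj G v u × missing u ≡ p
    by-cases (inj₁ eq)        = x , adj-x , lift adj-x eq
    by-cases (inj₂ (inj₁ eq)) = y , adj-y , lift adj-y eq
    by-cases (inj₂ (inj₂ eq)) = z , adj-z , lift adj-z eq

  missing-surj : Fin (n G) → ∀ p → Σ (Fin (n G)) λ v → missing v ≡ p
  missing-surj v p = by-cases (diameter-two (missing v) p)
    where
    by-cases : missing v ≡ p ⊎ Adj Petersen (missing v) p ⊎
               ∃ (λ q → Adj Petersen (missing v) q × Adj Petersen q p) →
               Σ (Fin (n G)) λ w → missing w ≡ p
    by-cases (inj₁ eq) = v , eq
    by-cases (inj₂ (inj₁ vp)) = let u , _ , eq = missing-localSurj v p vp in u , eq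
    by-cases (inj₂ (inj₂ (q , vq , qp))) =
      let u , _ , uq = missing-localSurj v q vq
          w , _ , wp = missing-localSurj u p (≡.subst (λ r → Adj Petersen r p) (≡.sym uq) qp)
      in w , wp

  missing-covering : Fin (n G) → Covers G Petersen
  missing-covering v = record
    { f = missing ; hom = λ vu → proj₁ (missing-edge vu) ; surj = missing-surj v
    ; localInj = missing-localInj ; localSurj = missing-localSurj }

strongColourable⇒5≤ : ∀ {G k} → Cubic G → Fin (n G) → StrongColourable G k → 5 ≤ k
strongColourable⇒5≤ {G} cubic v (c , strong) =
  five-colours-at-edge adj-x (otherNeighbours adj-x) (otherNeighbours (Graph.sym G adj-x))
  where
  open CubicGraph {G} cubic
  open StrongColouring c strong
  open Neighbours (neighbours v)

corollary5 : (G : Graph) → Cubic G →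
    (IsStrongChromaticIndex G 5 → Covers G Petersen) ×
    (Covers G Petersen → IsStrongChromaticIndex G 5)
corollary5 G cubic = index⇒covering , covering⇒index
  where
  index⇒covering : IsStrongChromaticIndex G 5 → Covers G Petersen
  index⇒covering ((c , strong) , minimal) = MissingColours.missing-covering cubic c strong
    (fin-stable (n G) λ no-vertex → case minimal 0 (strongColourable-empty no-vertex) of λ ())

  covering⇒index : Covers G Petersen → IsStrongChromaticIndex G 5
  covering⇒index π =
    (pullback π petersenColouring , pullback-strong π petersenColouring petersenColouring-strong) ,
    λ _ → strongColourable⇒5≤ {G} cubic (proj₁ (CoveringProjection.surj π zero))
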